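{- Let $K\ge1$, let $G=(V,E)$ be a $K$-edge-connected graph with a cactus representation $(\mathfrak C_G,\phi)$ such that $|\phi^{ -1}(b)|\le 1$ for every node $b$ of $\mathfrak C_G$. Let $\delta(Z)$ be a basic $K$-cut of $G$ and let $(T,w)$ be a safe tree in $G$ with $T\cap\delta(Z)\neq\emptyset$. Then all edges of $T\cap\delta(Z)$ have a common endpoint.
   Context: For $\emptyset\neq X\subsetneq V$, $\delta(X)$ is the set of edges of $G$ with exactly one endpoint in $X$; it is a $K$-cut if $|\delta(X)|=K$. $G$ is $K$-edge-connected if it is connected and stays connected after deleting any $K-1$ edges. A cactus is a connected multigraph (nodes and links) in which every link lies on exactly one cycle (cycles of length $2$ allowed). A cactus representation of $G$ is a cactus $\mathfrak C_G=(U,F)$ with a map $\phi:V\to U$ such that for every $X\subseteq V$, $\delta(X)$ is a $K$-cut of $G$ iff $X=\phi^{ -1}(Q)$ for some $Q\subseteq U$ such that exactly two links join $Q$ and $U\setminus Q$ (a $2$-cut of $\mathfrak C_G$); each $2$-cut consists of two links of a common cycle. A $K$-cut is basic if it is represented by a $2$-cut consisting of two links of a common cycle that share a node. A tree in $G$ is a subgraph of $G$ that is a tree. For a tree $T$ in $G$, a vertex $w$ of $T$ and an edge $e$ of $T$, let $T^{w}_{\mathrm{out}}(e)$ be the vertex set of the component of $T-e$ not containing $w$. The rooted tree $(T,w)$ is safe if $|\delta(T^{w}_{\mathrm{out}}(e))|=K$ for every edge $e$ of $T$. -}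

module Defs where

open import Data.Nat using (ℕ; zero; suc; _+_; _≤_; _<_)
open import Data.Fin using (Fin; _≟_) renaming (zero to fz; suc to fs)
open import Data.Bool using (Bool; true; false; _∧_; _xor_; not; if_then_else_)
open import Data.Product using (Σ; _×_; _,_; ∃; ∃-syntax)
open import Data.Sum using (_⊎_)
open import Relation.Nullary using (¬_)
open import Relation.Nullary.Decidable using (⌊_⌋)
open import Relation.Binary.PropositionalEquality using (_≡_)

-- Finite undirected multigraphs: vertices Fin nV, edges Fin nE,
-- each edge has two (unordered) endpoints src/tgt.

record Graph : Set where
  field
    nV  : ℕ
    nE  : ℕ
    src : Fin nE → Fin nV
    tgt : Fin nE → Fin nV
open Graph public

VSet : Graph → Set
VSet G = Fin (nV G) → Bool

ESet : Graph → Set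
ESet G = Fin (nE G) → Bool

count : ∀ {k} → (Fin k → Bool) → ℕ
count {zero}  P = 0
count {suc k} P = (if P fz then 1 else 0) + count (λ i → P (fs i))

_∈ᵇ_ : ∀ {k} → Fin k → (Fin k → Bool) → Set
x ∈ᵇ P = P x ≡ true

δ : (G : Graph) → VSet G → ESet G
δ G X e = X (src G e) xor X (tgt G e)

cutSize : (G : Graph) → VSet G → ℕ
cutSize G X = count (δ G X)

data Reach (G : Graph) (S : ESet G) : Fin (nV G) → Fin (nV G) → Set where
  here  : ∀ {u} → Reach G S u u
  fwd   : ∀ {u v} (e : Fin (nE G)) → S e ≡ true → src G e ≡ u →
          Reach G S (tgt G e) v → Reach G S u v
  bwd   : ∀ {u v} (e : Fin (nE G)) → S e ≡ true → tgt G e ≡ u →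
          Reach G S (src G e) v → Reach G S u v

allEdges : (G : Graph) → ESet G
allEdges G e = true

Connected : Graph → Set
Connected G = ∀ u v → Reach G (allEdges G) u v

KEdgeConnected : ℕ → Graph → Set
KEdgeConnected K G =
  Connected G × (∀ (F : ESet G) → count F < K → ∀ u v → Reach G (λ e → not (F e)) u v)

IsKCut : (G : Graph) → ℕ → VSet G → Set
IsKCut G K X = (∃[ v ] X v ≡ true) × (∃[ v ] X v ≡ false) × cutSize G X ≡ K

-- Degree of node b in the edge set C (loops counted twice).
degIn : (G : Graph) → ESet G → Fin (nV G) → ℕ
degIn G C b = count (λ f → C f ∧ ⌊ src G f ≟ b ⌋) + count (λ f → C f ∧ ⌊ tgt G f ≟ b ⌋)

-- A cycle (as a set of edges/links): at least two edges, every vertex has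
-- degree 0 or 2 in C, and C is connected. (Cycles of length 2 are allowed;
-- a single loop is not a cycle.)
IsCycle : (G : Graph) → ESet G → Set
IsCycle G C =
  (2 ≤ count C) ×
  (∀ b → degIn G C b ≡ 0 ⊎ degIn G C b ≡ 2) ×
  (∀ f g → C f ≡ true → C g ≡ true → Reach G C (src G f) (src G g))

IsCactus : Graph → Set
IsCactus H =
  Connected H ×
  (∀ f → Σ (ESet H) λ C → IsCycle H C × C f ≡ true ×
           (∀ C' → IsCycle H C' → C' f ≡ true → ∀ g → C' g ≡ C g))

record CactusRep (K : ℕ) (G : Graph) : Set where
  field
    cactus   : Graph
    isCactus : IsCactus cactus
    φ        : Fin (nV G) → Fin (nV cactus)
    sound    : ∀ (X : VSet G) → IsKCut G K X →
               Σ (VSet cactus) λ Q → (∀ v → X v ≡ Q (φ v)) × cutSize cactus Q ≡ 2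
    complete : ∀ (X : VSet G) (Q : VSet cactus) →
               (∀ v → X v ≡ Q (φ v)) → cutSize cactus Q ≡ 2 → IsKCut G K X
open CactusRep public

AtMostOnePerNode : ∀ {K G} → CactusRep K G → Set
AtMostOnePerNode {G = G} R = ∀ b → count (λ v → ⌊ φ R v ≟ b ⌋) ≤ 1

ShareNode : (H : Graph) → Fin (nE H) → Fin (nE H) → Set
ShareNode H f₁ f₂ =
  Σ (Fin (nV H)) λ b → (src H f₁ ≡ b ⊎ tgt H f₁ ≡ b) × (src H f₂ ≡ b ⊎ tgt H f₂ ≡ b)

IsBasicKCut : ∀ {K G} → CactusRep K G → VSet G → Set
IsBasicKCut {K} {G} R Z =
  IsKCut G K Z ×
  Σ (VSet H) λ Q → (∀ v → Z v ≡ Q (φ R v)) ×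
  Σ (Fin (nE H)) λ f₁ → Σ (Fin (nE H)) λ f₂ →
    ¬ (f₁ ≡ f₂) × δ H Q f₁ ≡ true × δ H Q f₂ ≡ true ×
    (∀ f → δ H Q f ≡ true → f ≡ f₁ ⊎ f ≡ f₂) ×
    (Σ (ESet H) λ C → IsCycle H C × C f₁ ≡ true × C f₂ ≡ true) ×
    ShareNode H f₁ f₂
  where H = cactus R

record Tree (G : Graph) : Set where
  field
    TV       : VSet G
    TE       : ESet G
    ends-in  : ∀ e → TE e ≡ true → TV (src G e) ≡ true × TV (tgt G e) ≡ true
    nonempty : ∃[ v ] TV v ≡ true
    conn     : ∀ u v → TV u ≡ true → TV v ≡ true → Reach G TE u v
    noLoop   : ∀ e → TE e ≡ true → ¬ (src G e ≡ tgt G e)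
    acyclic  : ∀ C → IsCycle G C → ¬ (∀ e → C e ≡ true → TE e ≡ true)
open Tree public

removeEdge : ∀ {G} → ESet G → Fin (nE G) → ESet G
removeEdge S e f = S f ∧ not ⌊ f ≟ e ⌋

IsTout : ∀ {G} → Tree G → Fin (nV G) → Fin (nE G) → VSet G → Set
IsTout {G} T w e X =
  ∀ v → (X v ≡ true → TV {G} T v ≡ true × ¬ Reach G (removeEdge {G} (TE {G} T) e) w v) ×
        (TV {G} T v ≡ true → ¬ Reach G (removeEdge {G} (TE {G} T) e) w v → X v ≡ true)

Safe : ℕ → (G : Graph) → Tree G → Fin (nV G) → Set
Safe K G T w =
  TV T w ≡ true ×
  (∀ e → TE T e ≡ true → ∀ X → IsTout T w e X → cutSize G X ≡ K)

{-# OPTIONS --safe #-}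
-- A basic K-cut δ(Z) crosses no K-cut of G. In the cactus, Z is represented by a set Q whose
-- leaving links meet at a node b; complementing, b lies in Q and in the representative P of the
-- other cut. If they crossed, δ(Q ∖ P) ⊆ δ(P) (links leaving Q touch b ∈ P), and since a cactus
-- is 2-edge-connected both cuts have two links, so δ(Q ∖ P) = δ(P). Then Q ∪ P = P ⊕ (Q ∖ P)
-- would be a proper nonempty set of nodes with no leaving link.
--
-- For a safe tree (T, w) every T^w_out(f) is a K-cut missing w. Orient tree edges away from w.
-- If a tree edge of δ(Z) has its upper end p ≠ w, then the K-cut below the parent edge of p
-- contains both ends of it, hence meets both sides of Z; not crossing Z, it contains the whole
-- side of Z opposite to w. So if two tree edges of δ(Z) had no common end, each would lie below
-- the parent edge of the other's upper end, forcing the two upper ends to coincide. Finally,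
-- edges of δ(Z) that pairwise meet have a common end, as a triangle cannot be 2-coloured.

module Submission where

open import Algebra.Bundles using (CommutativeRing)
open import Data.Bool using (Bool; true; false; _∧_; _∨_; _xor_; not; if_then_else_) renaming (_≟_ to _≟ᵇ_)
open import Data.Bool.Properties
  using (¬-not; not-involutive; ∧-assoc; ∧-identityʳ; ∧-zeroʳ; ∧-conicalˡ; ∧-conicalʳ; ∨-zeroʳ;
         xor-assoc; xor-same; xor-identityʳ; xor-inverseʳ; xor-∧-commutativeRing)
open import Algebra.Properties.CommutativeSemigroup
  (CommutativeRing.+-commutativeSemigroup xor-∧-commutativeRing) using (interchange)
open import Data.Empty using (⊥)
open import Data.Fin using (Fin; _≟_) renaming (zero to fz; suc to fs)
open import Data.Fin.Properties using (any?)
open import Data.Nat using (ℕ; zero; suc; _+_; _*_; _≤_; _<_; z≤n; s≤s; >-nonZero)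
open import Data.Nat.Divisibility using (_∣_; _∣0; ∣-refl; ∣m∣n⇒∣m+n; ∣m+n∣m⇒∣n; m∣m*n; ∣⇒≤)
open import Data.Nat.Properties
  using (+-*-semiring; ≤-trans; <⇒≱; ≤⇒≯; m≤n⇒m≤1+n; m≤n+m; +-suc; +-identityʳ; +-monoˡ-≤)
open import Algebra.Properties.Semiring.Sum +-*-semiring
  using (sum; ∑-comm; ∑-distrib-+; sum-cong-≗; sum-replicate-zero; *-distribˡ-sum)
open import Data.Product using (Σ; ∃-syntax; _×_; _,_; proj₁; proj₂)
open import Data.Sum using (_⊎_; inj₁; inj₂; [_,_])
open import Function using (id; _∘_)
open import Relation.Nullary using (¬_; yes; no; Dec; contradiction)
open import Relation.Nullary.Decidable
  using (⌊_⌋; isYes≗does; dec-true; dec-false; decidable-stable; ¬?; _×-dec_; _⊎-dec_)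
open import Relation.Binary.PropositionalEquality
  using (_≡_; _≢_; refl; sym; trans; cong; cong₂; subst; module ≡-Reasoning)

open import Defs

xor≡true⇒≢ : ∀ {a b} → a xor b ≡ true → a ≢ b
xor≡true⇒≢ {true}  ()  refl
xor≡true⇒≢ {false} ()  refl

≢⇒xor≡true : ∀ {a b} → a ≢ b → a xor b ≡ true
≢⇒xor≡true {true}  {true}  a≢b = contradiction refl a≢b
≢⇒xor≡true {true}  {false} _   = refl
≢⇒xor≡true {false} {true}  _   = refl
≢⇒xor≡true {false} {false} a≢b = contradiction refl a≢b

xor-cancelʳ : ∀ a b k → (a xor k) xor (b xor k) ≡ a xor b
xor-cancelʳ a b k = trans (interchange a k b k) (trans (cong ((a xor b) xor_) (xor-same k)) (xor-identityʳ _))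

xor-moveʳ : ∀ {x c} k → x ≡ c xor k → x xor k ≡ c
xor-moveʳ {c = c} k refl = trans (xor-assoc c k k) (trans (cong (c xor_) (xor-same k)) (xor-identityʳ c))

∨-true⁻ : ∀ a {b} → a ∨ b ≡ true → a ≡ true ⊎ b ≡ true
∨-true⁻ true  _ = inj₁ refl
∨-true⁻ false b = inj₂ b

three-distinct : ∀ {a b c : Bool} → a ≢ b → b ≢ c → a ≢ c → ⊥
three-distinct {c = c} a≢b b≢c a≢c = a≢c (trans (¬-not a≢b) (trans (cong not (¬-not b≢c)) (not-involutive c)))

≢-cover : ∀ {x y : Bool} → x ≢ y → ∀ a → a ≡ x ⊎ a ≡ y
≢-cover {x} x≢y a with a ≟ᵇ x
... | yes a≡x = inj₁ a≡x
... | no  a≢x = inj₂ (trans (¬-not a≢x) (sym (¬-not (x≢y ∘ sym))))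

∧-true : ∀ {a b} → a ≡ true → b ≡ true → a ∧ b ≡ true
∧-true refl refl = refl

isYes⇒ : ∀ {A : Set} (a? : Dec A) → ⌊ a? ⌋ ≡ true → A
isYes⇒ (yes a) _ = a

isYes-true : ∀ {A : Set} (a? : Dec A) → A → ⌊ a? ⌋ ≡ true
isYes-true a? a = trans (isYes≗does a?) (dec-true a? a)

isYes-false : ∀ {A : Set} (a? : Dec A) → ¬ A → ⌊ a? ⌋ ≡ false
isYes-false a? ¬a = trans (isYes≗does a?) (dec-false a? ¬a)

infix 4 _⊆ᵇ_

_⊆ᵇ_ : ∀ {k} → (Fin k → Bool) → (Fin k → Bool) → Set
P ⊆ᵇ Q = ∀ i → i ∈ᵇ P → i ∈ᵇ Q

⊆ᵇ-antisym : ∀ {k} {P Q : Fin k → Bool} → P ⊆ᵇ Q → Q ⊆ᵇ P → ∀ i → P i ≡ Q i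
⊆ᵇ-antisym {P = P} {Q} P⊆Q Q⊆P i with P i in Pi | Q i in Qi
... | true  | true  = refl
... | false | false = refl
... | true  | false = trans (sym (P⊆Q i Pi)) Qi
... | false | true  = trans (sym Pi) (Q⊆P i Qi)

count-cong : ∀ {k} {P Q : Fin k → Bool} → (∀ i → P i ≡ Q i) → count P ≡ count Q
count-cong {zero}  P≗Q = refl
count-cong {suc k} P≗Q rewrite P≗Q fz = cong (_ +_) (count-cong (λ i → P≗Q (fs i)))

count-≤ : ∀ {k} (P : Fin k → Bool) → count P ≤ k
count-≤ {zero}  P = z≤n
count-≤ {suc k} P with P fz
... | true  = s≤s (count-≤ (λ i → P (fs i)))
... | false = m≤n⇒m≤1+n (count-≤ (λ i → P (fs i)))

count-mono : ∀ {k} {P Q : Fin k → Bool} → P ⊆ᵇ Q → count P ≤ count Q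
count-mono {zero}  P⊆Q = z≤n
count-mono {suc k} {P} {Q} P⊆Q with P fz in P0 | Q fz in Q0
... | true  | true  = s≤s (count-mono (λ i → P⊆Q (fs i)))
... | true  | false = contradiction (trans (sym (P⊆Q fz P0)) Q0) λ ()
... | false | true  = m≤n⇒m≤1+n (count-mono (λ i → P⊆Q (fs i)))
... | false | false = count-mono (λ i → P⊆Q (fs i))

count-strict : ∀ {k} {P Q : Fin k → Bool} → P ⊆ᵇ Q →
               ∀ j → j ∈ᵇ Q → P j ≡ false → count P < count Q
count-strict {suc k} {P} {Q} P⊆Q fz Qj Pj rewrite Qj | Pj = s≤s (count-mono (λ i → P⊆Q (fs i)))
count-strict {suc k} {P} {Q} P⊆Q (fs j) Qj Pj with P fz in P0 | Q fz in Q0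
... | true  | true  = s≤s (count-strict (λ i → P⊆Q (fs i)) j Qj Pj)
... | true  | false = contradiction (trans (sym (P⊆Q fz P0)) Q0) λ ()
... | false | true  = m≤n⇒m≤1+n (count-strict (λ i → P⊆Q (fs i)) j Qj Pj)
... | false | false = count-strict (λ i → P⊆Q (fs i)) j Qj Pj

count-⊆-≥⇒⊇ : ∀ {k} {P Q : Fin k → Bool} → P ⊆ᵇ Q → count Q ≤ count P → Q ⊆ᵇ P
count-⊆-≥⇒⊇ {P = P} P⊆Q Q≤P i Qi with P i in Pi
... | true  = refl
... | false = contradiction Q≤P (<⇒≱ (count-strict P⊆Q i Qi Pi))

count-pos : ∀ {k} {P : Fin k → Bool} i → i ∈ᵇ P → 0 < count P
count-pos {P = P} fz     Pi rewrite Pi = s≤s z≤n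
count-pos {P = P} (fs i) Pi with P fz
... | true  = s≤s z≤n
... | false = count-pos i Pi

count-pos⇒∃ : ∀ {k} (P : Fin k → Bool) → 0 < count P → ∃[ i ] i ∈ᵇ P
count-pos⇒∃ {suc k} P 0<c with P fz in P0
... | true  = fz , P0
... | false = let i , Pi = count-pos⇒∃ (λ i → P (fs i)) 0<c in fs i , Pi

𝟙 : Bool → ℕ
𝟙 b = if b then 1 else 0

count≡∑ : ∀ {k} (P : Fin k → Bool) → count P ≡ sum (λ i → 𝟙 (P i))
count≡∑ {zero}  P = refl
count≡∑ {suc k} P = cong (𝟙 (P fz) +_) (count≡∑ (λ i → P (fs i)))

∑-single : ∀ {k} (f : Fin k → ℕ) x → (∀ v → v ≢ x → f v ≡ 0) → sum f ≡ f x
∑-single {suc k} f fz     vanish = begin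
  f fz + sum (λ v → f (fs v))  ≡⟨ cong (f fz +_) (sum-cong-≗ (λ v → vanish (fs v) λ ())) ⟩
  f fz + sum {k} (λ _ → 0)     ≡⟨ cong (f fz +_) (sum-replicate-zero k) ⟩
  f fz + 0                     ≡⟨ +-identityʳ (f fz) ⟩
  f fz                         ∎
  where open ≡-Reasoning
∑-single {suc k} f (fs x) vanish
  rewrite vanish fz (λ ()) = ∑-single (λ v → f (fs v)) x (λ v v≢x → vanish (fs v) λ { refl → v≢x refl })

∑-pointMass : ∀ {k} (P : Fin k → Bool) (x : Fin k) → sum (λ v → 𝟙 (P v ∧ ⌊ x ≟ v ⌋)) ≡ 𝟙 (P x)
∑-pointMass P x = begin
  sum (λ v → 𝟙 (P v ∧ ⌊ x ≟ v ⌋))  ≡⟨ ∑-single _ x off-x ⟩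
  𝟙 (P x ∧ ⌊ x ≟ x ⌋)              ≡⟨ cong (λ b → 𝟙 (P x ∧ b)) (isYes-true (x ≟ x) refl) ⟩
  𝟙 (P x ∧ true)                   ≡⟨ cong 𝟙 (∧-identityʳ (P x)) ⟩
  𝟙 (P x)                          ∎
  where
  open ≡-Reasoning
  off-x : ∀ v → v ≢ x → 𝟙 (P v ∧ ⌊ x ≟ v ⌋) ≡ 0
  off-x v v≢x rewrite isYes-false (x ≟ v) (λ x≡v → v≢x (sym x≡v)) | ∧-zeroʳ (P v) = refl

∑-even : ∀ {k} (f : Fin k → ℕ) → (∀ i → 2 ∣ f i) → 2 ∣ sum f
∑-even {zero}  f even = 2 ∣0
∑-even {suc k} f even = ∣m∣n⇒∣m+n (even fz) (∑-even (λ i → f (fs i)) (λ i → even (fs i)))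

data Incident (G : Graph) (e : Fin (nE G)) (x : Fin (nV G)) : Set where
  at-src : src G e ≡ x → Incident G e x
  at-tgt : tgt G e ≡ x → Incident G e x

Incident⁺ : ∀ {G e x} → src G e ≡ x ⊎ tgt G e ≡ x → Incident G e x
Incident⁺ = [ at-src , at-tgt ]

Incident⁻ : ∀ {G e x} → Incident G e x → src G e ≡ x ⊎ tgt G e ≡ x
Incident⁻ (at-src s≡x) = inj₁ s≡x
Incident⁻ (at-tgt t≡x) = inj₂ t≡x

data Joins (G : Graph) (e : Fin (nE G)) (a b : Fin (nV G)) : Set where
  forward  : src G e ≡ a → tgt G e ≡ b → Joins G e a b
  backward : src G e ≡ b → tgt G e ≡ a → Joins G e a b

module _ {G : Graph} {e : Fin (nE G)} where

  Joins-sym : ∀ {a b} → Joins G e a b → Joins G e b a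
  Joins-sym (forward  s t) = backward s t
  Joins-sym (backward s t) = forward  s t

  Joins⇒Incidentˡ : ∀ {a b} → Joins G e a b → Incident G e a
  Joins⇒Incidentˡ (forward  s _) = at-src s
  Joins⇒Incidentˡ (backward _ t) = at-tgt t

  Joins⇒Incidentʳ : ∀ {a b} → Joins G e a b → Incident G e b
  Joins⇒Incidentʳ j = Joins⇒Incidentˡ (Joins-sym j)

  Joins-Incident : ∀ {a b c} → Joins G e a b → Incident G e c → c ≡ a ⊎ c ≡ b
  Joins-Incident (forward  refl refl) (at-src refl) = inj₁ refl
  Joins-Incident (forward  refl refl) (at-tgt refl) = inj₂ refl
  Joins-Incident (backward refl refl) (at-src refl) = inj₂ refl
  Joins-Incident (backward refl refl) (at-tgt refl) = inj₁ refl

  Incident⇒Joins : ∀ {a b} → Incident G e a → Incident G e b → a ≢ b → Joins G e a b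
  Incident⇒Joins (at-src refl) (at-src refl) a≢b = contradiction refl a≢b
  Incident⇒Joins (at-src refl) (at-tgt refl) _   = forward refl refl
  Incident⇒Joins (at-tgt refl) (at-src refl) _   = backward refl refl
  Incident⇒Joins (at-tgt refl) (at-tgt refl) a≢b = contradiction refl a≢b

  Incident? : ∀ x → Dec (Incident G e x)
  Incident? x with src G e ≟ x | tgt G e ≟ x
  ... | yes s≡x | _       = yes (at-src s≡x)
  ... | no  _   | yes t≡x = yes (at-tgt t≡x)
  ... | no  s≢x | no  t≢x = no λ { (at-src s≡x) → s≢x s≡x ; (at-tgt t≡x) → t≢x t≡x }

δ-complement : ∀ G (S : VSet G) k e → δ G (λ v → S v xor k) e ≡ δ G S e
δ-complement G S k e = xor-cancelʳ (S (src G e)) (S (tgt G e)) k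

δ-Joins : ∀ {G} X {e a b} → e ∈ᵇ δ G X → Joins G e a b → X a ≢ X b
δ-Joins X e∈δ (forward  refl refl) = xor≡true⇒≢ e∈δ
δ-Joins X e∈δ (backward refl refl) = xor≡true⇒≢ e∈δ ∘ sym

δ-end-unlike : ∀ {G} X {e} → e ∈ᵇ δ G X → ∀ k → ∃[ z ] Incident G e z × X z ≢ k
δ-end-unlike {G} X {e} e∈δ k = pick (≢-cover s≢t k)
  where
  s≢t : X (src G e) ≢ X (tgt G e)
  s≢t = xor≡true⇒≢ e∈δ
  pick : k ≡ X (src G e) ⊎ k ≡ X (tgt G e) → ∃[ z ] Incident G e z × X z ≢ k
  pick (inj₁ k≡s) = tgt G e , at-tgt refl , λ t≡k → s≢t (trans (sym k≡s) (sym t≡k))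
  pick (inj₂ k≡t) = src G e , at-src refl , λ s≡k → s≢t (trans s≡k k≡t)

Reach-trans : ∀ {G S u v x} → Reach G S u v → Reach G S v x → Reach G S u x
Reach-trans here          q = q
Reach-trans (fwd e s p r) q = fwd e s p (Reach-trans r q)
Reach-trans (bwd e s p r) q = bwd e s p (Reach-trans r q)

Reach-mono : ∀ {G S S′ u v} → S ⊆ᵇ S′ → Reach G S u v → Reach G S′ u v
Reach-mono S⊆S′ here          = here
Reach-mono S⊆S′ (fwd e s p r) = fwd e (S⊆S′ e s) p (Reach-mono S⊆S′ r)
Reach-mono S⊆S′ (bwd e s p r) = bwd e (S⊆S′ e s) p (Reach-mono S⊆S′ r)

Reach-edge : ∀ {G S e a b} → e ∈ᵇ S → Joins G e a b → Reach G S a b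
Reach-edge {e = e} s (forward  refl refl) = fwd e s refl here
Reach-edge {e = e} s (backward refl refl) = bwd e s refl here

crossingEdge : ∀ {G S x y} (X : VSet G) → Reach G S x y → X x ≢ X y →
               ∃[ e ] e ∈ᵇ S × e ∈ᵇ δ G X
crossingEdge X here Xx≢Xy = contradiction refl Xx≢Xy
crossingEdge {G} X (fwd e s refl r) Xx≢Xy with X (tgt G e) ≟ᵇ X (src G e)
... | yes same = crossingEdge X r λ t≡y → Xx≢Xy (trans (sym same) t≡y)
... | no  diff = e , s , ≢⇒xor≡true λ eq → diff (sym eq)
crossingEdge {G} X (bwd e s refl r) Xx≢Xy with X (src G e) ≟ᵇ X (tgt G e)
... | yes same = crossingEdge X r λ s≡y → Xx≢Xy (trans (sym same) s≡y)
... | no  diff = e , s , ≢⇒xor≡true diff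

-- Cuts of a cactus

incidences-split : ∀ s t c → 𝟙 (s ∧ c) + 𝟙 (t ∧ c) ≡ 2 * 𝟙 (c ∧ (s ∧ t)) + 𝟙 (c ∧ (s xor t))
incidences-split true  true  true  = refl
incidences-split true  true  false = refl
incidences-split true  false true  = refl
incidences-split true  false false = refl
incidences-split false true  true  = refl
incidences-split false true  false = refl
incidences-split false false true  = refl
incidences-split false false false = refl

module Handshake (H : Graph) (C : ESet H) (S : VSet H) where

  endsAt : Fin (nE H) → Fin (nV H) → ℕ
  endsAt f v = 𝟙 (S v ∧ (C f ∧ ⌊ src H f ≟ v ⌋)) + 𝟙 (S v ∧ (C f ∧ ⌊ tgt H f ≟ v ⌋))

  degree-as-∑ : ∀ v → (if S v then degIn H C v else 0) ≡ sum (λ f → endsAt f v)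
  degree-as-∑ v = weighted (S v)
    where
    srcAt tgtAt : ESet H
    srcAt f = C f ∧ ⌊ src H f ≟ v ⌋
    tgtAt f = C f ∧ ⌊ tgt H f ≟ v ⌋
    weighted : ∀ s → (if s then degIn H C v else 0) ≡ sum (λ f → 𝟙 (s ∧ srcAt f) + 𝟙 (s ∧ tgtAt f))
    weighted true  = trans (cong₂ _+_ (count≡∑ srcAt) (count≡∑ tgtAt))
                           (sym (∑-distrib-+ (λ f → 𝟙 (srcAt f)) (λ f → 𝟙 (tgtAt f))))
    weighted false = sym (sum-replicate-zero (nE H))

  endsAt-∑ : ∀ f → sum (endsAt f) ≡ 𝟙 (S (src H f) ∧ C f) + 𝟙 (S (tgt H f) ∧ C f)
  endsAt-∑ f = trans (∑-distrib-+ (λ v → 𝟙 (S v ∧ (C f ∧ ⌊ src H f ≟ v ⌋)))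
                                  (λ v → 𝟙 (S v ∧ (C f ∧ ⌊ tgt H f ≟ v ⌋))))
                     (cong₂ _+_ (pointMass (src H f)) (pointMass (tgt H f)))
    where
    pointMass : ∀ x → sum (λ v → 𝟙 (S v ∧ (C f ∧ ⌊ x ≟ v ⌋))) ≡ 𝟙 (S x ∧ C f)
    pointMass x = trans (sum-cong-≗ λ v → cong 𝟙 (sym (∧-assoc (S v) (C f) _))) (∑-pointMass _ x)

  inside crossing : ESet H
  inside   f = C f ∧ (S (src H f) ∧ S (tgt H f))
  crossing f = C f ∧ δ H S f

  handshake : sum (λ v → if S v then degIn H C v else 0) ≡ 2 * count inside + count crossing
  handshake = begin
    sum (λ v → if S v then degIn H C v else 0)        ≡⟨ sum-cong-≗ degree-as-∑ ⟩
    sum (λ v → sum (λ f → endsAt f v))                 ≡⟨ ∑-comm (λ v f → endsAt f v) ⟩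
    sum (λ f → sum (endsAt f))                         ≡⟨ sum-cong-≗ split ⟩
    sum (λ f → 2 * 𝟙 (inside f) + 𝟙 (crossing f))
      ≡⟨ ∑-distrib-+ (λ f → 2 * 𝟙 (inside f)) (λ f → 𝟙 (crossing f)) ⟩
    sum (λ f → 2 * 𝟙 (inside f)) + sum (λ f → 𝟙 (crossing f))
      ≡⟨ cong₂ _+_ (sym (*-distribˡ-sum 2 (λ f → 𝟙 (inside f)))) refl ⟩
    2 * sum (λ f → 𝟙 (inside f)) + sum (λ f → 𝟙 (crossing f))
      ≡⟨ sym (cong₂ _+_ (cong (2 *_) (count≡∑ inside)) (count≡∑ crossing)) ⟩
    2 * count inside + count crossing                  ∎
    where
    open ≡-Reasoning
    split : ∀ f → sum (endsAt f) ≡ 2 * 𝟙 (inside f) + 𝟙 (crossing f)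
    split f = trans (endsAt-∑ f) (incidences-split (S (src H f)) (S (tgt H f)) (C f))

  cycle-crossings-even : IsCycle H C → 2 ∣ count crossing
  cycle-crossings-even (_ , degree , _) =
    ∣m+n∣m⇒∣n (subst (2 ∣_) handshake (∑-even _ even-term)) (m∣m*n (count inside))
    where
    even-term : ∀ v → 2 ∣ (if S v then degIn H C v else 0)
    even-term v with S v | degree v
    ... | false | _      = 2 ∣0
    ... | true  | inj₁ d = subst (2 ∣_) (sym d) (2 ∣0)
    ... | true  | inj₂ d = subst (2 ∣_) (sym d) ∣-refl

cactus-cut≥2 : ∀ {H} → IsCactus H → (S : VSet H) {x y : Fin (nV H)} → S x ≢ S y → 2 ≤ cutSize H S
cactus-cut≥2 {H} (connected , onCycle) S {x} {y} Sx≢Sy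
  with g , _ , g∈δS ← crossingEdge S (connected x y) Sx≢Sy
  with C , isCycle , g∈C , _ ← onCycle g
  = ≤-trans (∣⇒≤ ⦃ >-nonZero C∩δS>0 ⦄ (Handshake.cycle-crossings-even H C S isCycle))
            (count-mono (λ f f∈C∩δS → ∧-conicalʳ (C f) _ f∈C∩δS))
  where
  C∩δS>0 : 0 < count (λ f → C f ∧ δ H S f)
  C∩δS>0 = count-pos g (subst (λ b → b ∧ δ H S g ≡ true) (sym g∈C) g∈δS)

Crosses : ∀ {k} → (Fin k → Bool) → (Fin k → Bool) → Set
Crosses A B = ∀ a b → ∃[ v ] A v ≡ a × B v ≡ b

Crosses-complement : ∀ {k} {A B : Fin k → Bool} → Crosses A B →
                     ∀ kA kB → Crosses (λ v → A v xor kA) (λ v → B v xor kB)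
Crosses-complement crosses kA kB a b
  with v , Av , Bv ← crosses (a xor kA) (b xor kB)
  = v , xor-moveʳ kA Av , xor-moveʳ kB Bv

Crosses-image : ∀ {m n} {A B : Fin m → Bool} {A′ B′ : Fin n → Bool} (φ : Fin m → Fin n) →
                (∀ v → A v ≡ A′ (φ v)) → (∀ v → B v ≡ B′ (φ v)) → Crosses A B → Crosses A′ B′
Crosses-image φ A≗A′∘φ B≗B′∘φ crosses a b =
  let v , Av , Bv = crosses a b in φ v , trans (sym (A≗A′∘φ v)) Av , trans (sym (B≗B′∘φ v)) Bv

leaving-difference : ∀ qs ps qt pt → (qs ∧ not ps) xor (qt ∧ not pt) ≡ true →
                     ps xor pt ≡ true ⊎ (qs xor qt ≡ true × ps ≡ false × pt ≡ false)
leaving-difference _     true  _     false _ = inj₁ refl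
leaving-difference _     false _     true  _ = inj₁ refl
leaving-difference true  false false false _ = inj₂ (refl , refl , refl)
leaving-difference false false true  false _ = inj₂ (refl , refl , refl)
leaving-difference true  true  true  true  ()
leaving-difference true  true  false true  ()
leaving-difference false true  true  true  ()
leaving-difference false true  false true  ()
leaving-difference true  false true  false ()
leaving-difference false false false false ()

module _ {H : Graph} (cactus : IsCactus H) (Q P : VSet H) (b : Fin (nV H))
         (leaves-at-b : ∀ f → f ∈ᵇ δ H Q → Incident H f b) (cutP : cutSize H P ≡ 2) where

  private
    B : VSet H
    B v = Q v ∧ not (P v)

  -- δ(B) ⊆ δ(P) and |δ(B)| ≥ 2 = |δ(P)|, so δ(P ⊕ B) = δ(P) ⊕ δ(B) is empty;
  -- but P ⊕ B = P ∪ Q contains b and misses y.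
  cactus-noncrossing-b∈Q∩P : Q b ≡ true → P b ≡ true →
                             ∀ {x y} → Q x ≡ true → P x ≡ false → Q y ≡ false → P y ≡ false → ⊥
  cactus-noncrossing-b∈Q∩P Qb Pb {x} {y} Qx Px Qy Py =
    let g , _ , g∈δP⊕B = crossingEdge (λ v → P v xor B v) (proj₁ cactus b y) P⊕B-differs
        regroup = interchange (P (src H g)) (B (src H g)) (P (tgt H g)) (B (tgt H g))
    in xor≡true⇒≢ (trans (sym regroup) g∈δP⊕B) (δP≗δB g)
    where
    δB⊆δP : δ H B ⊆ᵇ δ H P
    δB⊆δP f f∈δB
      with leaving-difference (Q (src H f)) (P (src H f)) (Q (tgt H f)) (P (tgt H f)) f∈δB
    ... | inj₁ f∈δP = f∈δP
    ... | inj₂ (f∈δQ , Ps , Pt) with leaves-at-b f f∈δQ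
    ...   | at-src refl = contradiction (trans (sym Pb) Ps) λ ()
    ...   | at-tgt refl = contradiction (trans (sym Pb) Pt) λ ()

    2≤δB : 2 ≤ cutSize H B
    2≤δB = cactus-cut≥2 cactus B {x} {b} B-differs
      where
      B-differs : B x ≢ B b
      B-differs rewrite Qx | Px | Qb | Pb = λ ()

    δP≗δB : ∀ f → δ H P f ≡ δ H B f
    δP≗δB = ⊆ᵇ-antisym (count-⊆-≥⇒⊇ δB⊆δP (subst (_≤ cutSize H B) (sym cutP) 2≤δB)) δB⊆δP

    P⊕B-differs : P b xor B b ≢ P y xor B y
    P⊕B-differs rewrite Pb | Qb | Py | Qy = λ ()

-- Complementing Q and P changes neither their cuts nor whether they cross, and puts b in both.
cactus-noncrossing : ∀ {H} → IsCactus H → (Q P : VSet H) (b : Fin (nV H)) →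
                     (∀ f → f ∈ᵇ δ H Q → Incident H f b) → cutSize H P ≡ 2 → ¬ Crosses Q P
cactus-noncrossing {H} cactus Q P b leaves-at-b cutP crosses =
  let _ , Q′x , P′x = crosses′ true  false
      _ , Q′y , P′y = crosses′ false false
  in cactus-noncrossing-b∈Q∩P cactus Q′ P′ b leaves-at-b′ cutP′
       (xor-inverseʳ (Q b)) (xor-inverseʳ (P b)) Q′x P′x Q′y P′y
  where
  Q′ P′ : VSet H
  Q′ v = Q v xor not (Q b)
  P′ v = P v xor not (P b)
  leaves-at-b′ : ∀ f → f ∈ᵇ δ H Q′ → Incident H f b
  leaves-at-b′ f f∈δQ′ = leaves-at-b f (trans (sym (δ-complement H Q (not (Q b)) f)) f∈δQ′)
  cutP′ : cutSize H P′ ≡ 2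
  cutP′ = trans (count-cong (δ-complement H P (not (P b)))) cutP
  crosses′ : Crosses Q′ P′
  crosses′ = Crosses-complement crosses (not (Q b)) (not (P b))

basicKCut-noncrossing : ∀ {K G} (R : CactusRep K G) {Z} → IsBasicKCut R Z →
                        ∀ {Y} → IsKCut G K Y → ¬ Crosses Z Y
basicKCut-noncrossing R (_ , Q , Z≗Q∘φ , f₁ , f₂ , _ , _ , _ , only , _ , b , f₁∋b , f₂∋b) {Y} Ycut =
  let P , Y≗P∘φ , cutP = sound R Y Ycut
  in cactus-noncrossing (isCactus R) Q P b leaves-at-b cutP ∘ Crosses-image (φ R) Z≗Q∘φ Y≗P∘φ
  where
  leaves-at-b : ∀ f → f ∈ᵇ δ (cactus R) Q → Incident (cactus R) f b
  leaves-at-b f f∈δQ with only f f∈δQ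
  ... | inj₁ refl = Incident⁺ f₁∋b
  ... | inj₂ refl = Incident⁺ f₂∋b

-- Pairwise meeting edges of a cut

module _ (G : Graph) (X : VSet G) (D : ESet G) (D⊆δX : D ⊆ᵇ δ G X)
         (meet : ∀ {e₁ e₂} → e₁ ∈ᵇ D → e₂ ∈ᵇ D → ∃[ x ] Incident G e₁ x × Incident G e₂ x) where

  private
    meets-an-end : ∀ {e e₀} → e ∈ᵇ D → e₀ ∈ᵇ D → Incident G e (src G e₀) ⊎ Incident G e (tgt G e₀)
    meets-an-end e∈D e₀∈D with x , e∋x , e₀∋x ← meet e∈D e₀∈D
                            with Joins-Incident (forward refl refl) e₀∋x
    ... | inj₁ refl = inj₁ e∋x
    ... | inj₂ refl = inj₂ e∋x

  -- If some e₁ ∈ D misses src e₀, every e ∈ D contains tgt e₀: otherwise e, e₁ and e₀ would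
  -- form a triangle whose corners get pairwise different colours under X.
  meeting-edges-share-endpoint : ∀ {e₀} → e₀ ∈ᵇ D → ∃[ x ] ∀ e → e ∈ᵇ D → Incident G e x
  meeting-edges-share-endpoint {e₀} e₀∈D
    with any? (λ e → (D e ≟ᵇ true) ×-dec ¬? (Incident? {e = e} (src G e₀)))
  ... | no none = src G e₀ , λ e e∈D →
                    decidable-stable (Incident? (src G e₀)) λ e∌s → none (e , e∈D , e∌s)
  ... | yes (e₁ , e₁∈D , e₁∌s) = tgt G e₀ , λ e e∈D →
                    decidable-stable (Incident? (tgt G e₀)) (no-triangle e e∈D)
    where
    e₁∋t : Incident G e₁ (tgt G e₀)
    e₁∋t = [ (λ e₁∋s → contradiction e₁∋s e₁∌s) , id ] (meets-an-end e₁∈D e₀∈D)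
    no-triangle : ∀ e → e ∈ᵇ D → ¬ ¬ Incident G e (tgt G e₀)
    no-triangle e e∈D e∌t =
      let e∋s = [ id , (λ e∋t → contradiction e∋t e∌t) ] (meets-an-end e∈D e₀∈D)
          y , e∋y , e₁∋y = meet e∈D e₁∈D
          s≢y = λ s≡y → e₁∌s (subst (Incident G e₁) (sym s≡y) e₁∋y)
          y≢t = λ y≡t → e∌t (subst (Incident G e) y≡t e∋y)
      in three-distinct (δ-Joins X (D⊆δX e e∈D) (Incident⇒Joins e∋s e∋y s≢y))
                        (δ-Joins X (D⊆δX e₁ e₁∈D) (Incident⇒Joins e₁∋y e₁∋t y≢t))
                        (xor≡true⇒≢ (D⊆δX e₀ e₀∈D))

-- Paths avoiding an edge, and reachability

module Paths (G : Graph) where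

  infixl 30 _∖_

  _∖_ : ESet G → Fin (nE G) → ESet G
  S ∖ e = removeEdge {G} S e

  ∖-⊆ : ∀ S e → S ∖ e ⊆ᵇ S
  ∖-⊆ S e f = ∧-conicalˡ (S f) _

  ∖-keeps : ∀ S {e f} → f ∈ᵇ S → f ≢ e → f ∈ᵇ S ∖ e
  ∖-keeps S {e} {f} f∈S f≢e rewrite f∈S | isYes-false (f ≟ e) f≢e = refl

  ∖-drops : ∀ S e {f} → f ∈ᵇ S ∖ e → f ≢ e
  ∖-drops S e {f} f∈S∖e f≡e =
    contradiction (subst (λ d → not d ≡ true) (isYes-true (f ≟ e) f≡e) (∧-conicalʳ (S f) _ f∈S∖e)) λ ()

  ∖-comm-⊆ : ∀ S e f → S ∖ e ∖ f ⊆ᵇ S ∖ f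
  ∖-comm-⊆ S e f g g∈ = ∖-keeps S (∖-⊆ S e g (∖-⊆ (S ∖ e) f g g∈)) (∖-drops (S ∖ e) f g∈)

  first-use : ∀ {S a v} → Reach G S a v → ∀ e →
              Reach G (S ∖ e) a v ⊎ ∃[ x ] Incident G e x × Reach G (S ∖ e) a x
  first-use here e = inj₁ here
  first-use {S} (fwd f f∈S refl r) e with f ≟ e
  ... | yes refl = inj₂ (src G e , at-src refl , here)
  ... | no  f≢e with first-use r e
  ...   | inj₁ r′             = inj₁ (fwd f (∖-keeps S f∈S f≢e) refl r′)
  ...   | inj₂ (x , e∋x , r′) = inj₂ (x , e∋x , fwd f (∖-keeps S f∈S f≢e) refl r′)
  first-use {S} (bwd f f∈S refl r) e with f ≟ e
  ... | yes refl = inj₂ (tgt G e , at-tgt refl , here)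
  ... | no  f≢e with first-use r e
  ...   | inj₁ r′             = inj₁ (bwd f (∖-keeps S f∈S f≢e) refl r′)
  ...   | inj₂ (x , e∋x , r′) = inj₂ (x , e∋x , bwd f (∖-keeps S f∈S f≢e) refl r′)

  last-use : ∀ {S a v} → Reach G S a v → ∀ e →
             Reach G (S ∖ e) a v ⊎ ∃[ x ] Incident G e x × Reach G (S ∖ e) x v
  last-use here e = inj₁ here
  last-use {S} (fwd f f∈S refl r) e with last-use r e
  ... | inj₂ later = inj₂ later
  ... | inj₁ r′ with f ≟ e
  ...   | yes refl = inj₂ (tgt G e , at-tgt refl , r′)
  ...   | no  f≢e  = inj₁ (fwd f (∖-keeps S f∈S f≢e) refl r′)
  last-use {S} (bwd f f∈S refl r) e with last-use r e
  ... | inj₂ later = inj₂ later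
  ... | inj₁ r′ with f ≟ e
  ...   | yes refl = inj₂ (src G e , at-src refl , r′)
  ...   | no  f≢e  = inj₁ (bwd f (∖-keeps S f∈S f≢e) refl r′)

  last-edge : ∀ {S a v} → a ≢ v → Reach G S a v →
              ∃[ e ] e ∈ᵇ S × ∃[ u ] Joins G e u v × Reach G (S ∖ e) a u
  last-edge a≢v here = contradiction refl a≢v
  last-edge {S} {a} {v} a≢v (fwd f f∈S refl r) with tgt G f ≟ v
  ... | yes t≡v = f , f∈S , a , forward refl t≡v , here
  ... | no  t≢v with e , e∈S , u , e-joins , r′ ← last-edge t≢v r
    = e , e∈S , u , e-joins , fwd f (∖-keeps S f∈S f≢e) refl r′
    where
    f≢e : f ≢ e
    f≢e refl = [ a≢v , t≢v ] (Incident⁻ (Joins⇒Incidentʳ e-joins))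
  last-edge {S} {a} {v} a≢v (bwd f f∈S refl r) with src G f ≟ v
  ... | yes s≡v = f , f∈S , a , backward s≡v refl , here
  ... | no  s≢v with e , e∈S , u , e-joins , r′ ← last-edge s≢v r
    = e , e∈S , u , e-joins , bwd f (∖-keeps S f∈S f≢e) refl r′
    where
    f≢e : f ≢ e
    f≢e refl = [ s≢v , a≢v ] (Incident⁻ (Joins⇒Incidentʳ e-joins))

module Reachability (G : Graph) (S : ESet G) (w : Fin (nV G)) where

  StepInto : VSet G → Fin (nE G) → Fin (nV G) → Set
  StepInto R f v = f ∈ᵇ S × ((src G f ∈ᵇ R × tgt G f ≡ v) ⊎ (tgt G f ∈ᵇ R × src G f ≡ v))

  stepInto? : ∀ R f v → Dec (StepInto R f v)
  stepInto? R f v = (S f ≟ᵇ true) ×-dec (((R (src G f) ≟ᵇ true) ×-dec (tgt G f ≟ v))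
                                 ⊎-dec ((R (tgt G f) ≟ᵇ true) ×-dec (src G f ≟ v)))

  grow : VSet G → VSet G
  grow R v = R v ∨ ⌊ any? (λ f → stepInto? R f v) ⌋

  Sound Closed : VSet G → Set
  Sound  R = ∀ v → v ∈ᵇ R → Reach G S w v
  Closed R = ∀ v → v ∈ᵇ grow R → v ∈ᵇ R

  grow-⊇ : ∀ R → R ⊆ᵇ grow R
  grow-⊇ R v Rv rewrite Rv = refl

  grow-step : ∀ R f {v} → StepInto R f v → v ∈ᵇ grow R
  grow-step R f {v} step rewrite isYes-true (any? (λ f → stepInto? R f v)) (f , step) = ∨-zeroʳ (R v)

  grow-sound : ∀ R → Sound R → Sound (grow R)
  grow-sound R sound v v∈ with ∨-true⁻ (R v) v∈
  ... | inj₁ Rv = sound v Rv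
  ... | inj₂ step with isYes⇒ (any? (λ f → stepInto? R f v)) step
  ...   | f , f∈S , inj₁ (Rs , refl) = Reach-trans (sound _ Rs) (fwd f f∈S refl here)
  ...   | f , f∈S , inj₂ (Rt , refl) = Reach-trans (sound _ Rt) (bwd f f∈S refl here)

  closed-reach : ∀ {R u v} → Closed R → u ∈ᵇ R → Reach G S u v → v ∈ᵇ R
  closed-reach closed Ru here = Ru
  closed-reach {R} closed Ru (fwd e e∈S refl r) =
    closed-reach closed (closed _ (grow-step R e (e∈S , inj₁ (Ru , refl)))) r
  closed-reach {R} closed Ru (bwd e e∈S refl r) =
    closed-reach closed (closed _ (grow-step R e (e∈S , inj₂ (Ru , refl)))) r

  record Closure : Set where
    field
      reached : VSet G
      sound   : Sound reached
      origin  : w ∈ᵇ reached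
      closed  : Closed reached

  -- Each round that is not closed adds a vertex, so suc (nV G) rounds suffice.
  saturate : (fuel : ℕ) (R : VSet G) → Sound R → w ∈ᵇ R → nV G < count R + fuel → Closure
  saturate zero R _ _ overflow =
    contradiction (subst (nV G <_) (+-identityʳ (count R)) overflow) (≤⇒≯ (count-≤ R))
  saturate (suc fuel) R sound Rw bound with any? (λ v → (grow R v ≟ᵇ true) ×-dec (R v ≟ᵇ false))
  ... | no stable = record { reached = R ; sound = sound ; origin = Rw ; closed = closed }
    where
    closed : Closed R
    closed v v∈ = decidable-stable (R v ≟ᵇ true) λ Rv≢true → stable (v , v∈ , ¬-not Rv≢true)
  ... | yes (v , v∈ , Rv) = saturate fuel (grow R) (grow-sound R sound) (grow-⊇ R w Rw) bound′
    where
    bound′ : nV G < count (grow R) + fuel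
    bound′ = ≤-trans (subst (suc (nV G) ≤_) (+-suc (count R) fuel) bound)
                     (+-monoˡ-≤ fuel (count-strict (grow-⊇ R) v v∈ Rv))

  abstract
    closure : Closure
    closure = saturate (suc (nV G)) (λ v → ⌊ w ≟ v ⌋) start (isYes-true (w ≟ w) refl)
                       (m≤n+m (suc (nV G)) _)
      where
      start : Sound (λ v → ⌊ w ≟ v ⌋)
      start v w≡v with refl ← isYes⇒ (w ≟ v) w≡v = here

  open Closure closure public using (reached)

  reached-sound : ∀ {v} → v ∈ᵇ reached → Reach G S w v
  reached-sound = Closure.sound closure _

  reached-complete : ∀ {v} → Reach G S w v → v ∈ᵇ reached
  reached-complete = closed-reach (Closure.closed closure) (Closure.origin closure)

-- Safe trees

module SafeTree {K : ℕ} {G : Graph} (1≤K : 1 ≤ K) (T : Tree G) (w : Fin (nV G)) (safe : Safe K G T w) where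

  open Paths G

  w∈T : w ∈ᵇ TV T
  w∈T = proj₁ safe

  end∈T : ∀ {e x} → e ∈ᵇ TE T → Incident G e x → x ∈ᵇ TV T
  end∈T e∈T (at-src refl) = proj₁ (ends-in T _ e∈T)
  end∈T e∈T (at-tgt refl) = proj₂ (ends-in T _ e∈T)

  Below : Fin (nE G) → Fin (nV G) → Set
  Below f v = v ∈ᵇ TV T × ¬ Reach G (TE T ∖ f) w v

  below : Fin (nE G) → VSet G
  below f v = TV T v ∧ not (Reachability.reached G (TE T ∖ f) w v)

  below⇒Below : ∀ {f v} → v ∈ᵇ below f → Below f v
  below⇒Below {f} {v} v∈ =
    ∧-conicalˡ (TV T v) _ v∈ ,
    λ r → contradiction (subst (λ b → not b ≡ true) (Reachability.reached-complete G (TE T ∖ f) w r)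
                                 (∧-conicalʳ (TV T v) _ v∈)) λ ()

  Below⇒below : ∀ {f v} → Below f v → v ∈ᵇ below f
  Below⇒below {f} {v} (v∈T , unreached)
    rewrite v∈T | ¬-not (unreached ∘ Reachability.reached-sound G (TE T ∖ f) w) = refl

  w-not-below : ∀ f → ¬ Below f w
  w-not-below f (_ , unreached) = unreached here

  below-isTout : ∀ f → IsTout T w f (below f)
  below-isTout f v = below⇒Below , λ v∈T unreached → Below⇒below (v∈T , unreached)

  below-isKCut : ∀ {f} → f ∈ᵇ TE T → IsKCut G K (below f)
  below-isKCut {f} f∈T = inside , (w , ¬-not (w-not-below f ∘ below⇒Below)) , cut
    where
    cut : cutSize G (below f) ≡ K
    cut = proj₂ safe f f∈T (below f) (below-isTout f)
    inside : ∃[ v ] v ∈ᵇ below f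
    inside with g , g∈δ ← count-pos⇒∃ (δ G (below f)) (subst (1 ≤_) (sym cut) 1≤K)
                with below f (src G g) in s∈
    ... | true  = src G g , s∈
    ... | false = tgt G g , g∈δ

  Below-closed : ∀ {f g a b} → g ∈ᵇ TE T → g ≢ f → Joins G g a b → Below f a → Below f b
  Below-closed {f} {g} g∈T g≢f g-joins (_ , a-unreached) =
    end∈T g∈T (Joins⇒Incidentʳ g-joins) ,
    λ r → a-unreached (Reach-trans r (Reach-edge (∖-keeps (TE T) g∈T g≢f) (Joins-sym g-joins)))

  record Hangs (f : Fin (nE G)) (v : Fin (nV G)) : Set where
    field
      edge∈T        : f ∈ᵇ TE T
      upper         : Fin (nV G)
      joins         : Joins G f upper v
      upper-reached : Reach G (TE T ∖ f) w upper
      lower-below   : Below f v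

  tree-edge-hangs : ∀ {f} → f ∈ᵇ TE T → ∃[ v ] Hangs f v
  tree-edge-hangs {f} f∈T =
    let x , x∈below = proj₁ (below-isKCut f∈T)
        u , f∋u , u-below = below-end (below⇒Below x∈below)
        q , f∋q , q-reached = reached-end
        u≢q = λ u≡q → proj₂ u-below (subst (Reach G (TE T ∖ f) w) (sym u≡q) q-reached)
    in u , record { edge∈T = f∈T ; upper = q ; joins = Incident⇒Joins f∋q f∋u (u≢q ∘ sym)
                  ; upper-reached = q-reached ; lower-below = u-below }
    where
    below-end : ∀ {x} → Below f x → ∃[ u ] Incident G f u × Below f u
    below-end {x} (x∈T , x-unreached) with last-use (conn T w x w∈T x∈T) f
    ... | inj₁ r             = contradiction r x-unreached
    ... | inj₂ (u , f∋u , r) = u , f∋u , end∈T f∈T f∋u , λ r′ → x-unreached (Reach-trans r′ r)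
    reached-end : ∃[ q ] Incident G f q × Reach G (TE T ∖ f) w q
    reached-end with first-use (conn T w (src G f) w∈T (end∈T f∈T (at-src refl))) f
    ... | inj₁ r = src G f , at-src refl , r
    ... | inj₂ q = q

  parent-edge : ∀ {v} → v ∈ᵇ TV T → v ≢ w → ∃[ f ] Hangs f v
  parent-edge {v} v∈T v≢w
    with e , e∈T , u , e-joins , u-reached ← last-edge (v≢w ∘ sym) (conn T w v w∈T v∈T)
    with c , hangs ← tree-edge-hangs e∈T
    with Joins-Incident e-joins (Joins⇒Incidentʳ (Hangs.joins hangs))
  ... | inj₁ refl = contradiction u-reached (proj₂ (Hangs.lower-below hangs))
  ... | inj₂ refl = e , hangs

  upper-incident : ∀ {f v} (h : Hangs f v) → Incident G f (Hangs.upper h)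
  upper-incident h = Joins⇒Incidentˡ (Hangs.joins h)

  upper∈T : ∀ {f v} (h : Hangs f v) → Hangs.upper h ∈ᵇ TV T
  upper∈T h = end∈T (Hangs.edge∈T h) (upper-incident h)

  hanging-antisym : ∀ {f₁ f₂ v₁ v₂} → Hangs f₁ v₁ → Hangs f₂ v₂ →
                    Below f₁ v₂ → Below f₂ v₁ → v₁ ≡ v₂
  hanging-antisym {f₁} {f₂} h₁ h₂ (_ , v₂-unreached₁) (_ , v₁-unreached₂) with f₁ ≟ f₂
  ... | yes refl with Joins-Incident (Hangs.joins h₁) (Joins⇒Incidentʳ (Hangs.joins h₂))
  ...   | inj₁ refl  = contradiction (Hangs.upper-reached h₁) v₂-unreached₁
  ...   | inj₂ v₂≡v₁ = sym v₂≡v₁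
  hanging-antisym {f₁} {f₂} h₁ h₂ (_ , v₂-unreached₁) (_ , v₁-unreached₂) | no f₁≢f₂
    with first-use (Hangs.upper-reached h₁) f₂
  ... | inj₁ r = contradiction
          (Reach-trans (Reach-mono (∖-comm-⊆ (TE T) f₁ f₂) r)
                       (Reach-edge (∖-keeps (TE T) (Hangs.edge∈T h₁) f₁≢f₂) (Hangs.joins h₁)))
          v₁-unreached₂
  ... | inj₂ (x , f₂∋x , r) with Joins-Incident (Hangs.joins h₂) f₂∋x
  ...   | inj₂ refl = contradiction (Reach-mono (∖-⊆ (TE T ∖ f₁) f₂) r) v₂-unreached₁
  ...   | inj₁ refl = contradiction
          (Reach-trans (Reach-mono (∖-⊆ (TE T ∖ f₁) f₂) r)
                       (Reach-edge (∖-keeps (TE T) (Hangs.edge∈T h₂) (f₁≢f₂ ∘ sym)) (Hangs.joins h₂)))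
          v₂-unreached₁

  module NonCrossing (Z : VSet G) (noncrossing : ∀ {Y} → IsKCut G K Y → ¬ Crosses Z Y) where

    -- below f is a K-cut missing w and containing both ends of e, which lie on different sides
    -- of Z; missing z as well, it would cross Z.
    unlike-w-below-parent : ∀ {e c f} → e ∈ᵇ δ G Z → (h : Hangs e c) → Hangs f (Hangs.upper h) →
                            ∀ {z} → Z z ≢ Z w → Below f z
    unlike-w-below-parent {e} {c} {f} e∈δ h hf {z} Zz≢Zw with below f z in z∈?
    ... | true  = below⇒Below z∈?
    ... | false = contradiction crosses (noncrossing (below-isKCut (Hangs.edge∈T hf)))
      where
      p : Fin (nV G)
      p = Hangs.upper h
      p-below : Below f p
      p-below = Hangs.lower-below hf
      c-below : Below f c
      c-below = Below-closed (Hangs.edge∈T h) (λ { refl → proj₂ p-below (Hangs.upper-reached h) })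
                             (Hangs.joins h) p-below
      crosses : Crosses Z (below f)
      crosses a true with ≢-cover (δ-Joins Z e∈δ (Hangs.joins h)) a
      ... | inj₁ refl = p , refl , Below⇒below p-below
      ... | inj₂ refl = c , refl , Below⇒below c-below
      crosses a false with ≢-cover Zz≢Zw a
      ... | inj₁ refl = z , refl , z∈?
      ... | inj₂ refl = w , refl , ¬-not (w-not-below f ∘ below⇒Below)

    crossing-edge-below-parent : ∀ {e c f e′} → e ∈ᵇ δ G Z → (h : Hangs e c) → Hangs f (Hangs.upper h) →
                                 e′ ∈ᵇ TE T → e′ ∈ᵇ δ G Z → ¬ Incident G e′ (Hangs.upper h) →
                                 ∀ {x} → Incident G e′ x → Below f x
    crossing-edge-below-parent {f = f} {e′} e∈δ h hf e′∈T e′∈δ e′∌p {x} e′∋x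
      with z , e′∋z , Zz≢Zw ← δ-end-unlike Z e′∈δ (Z w)
      with x ≟ z
    ... | yes refl = unlike-w-below-parent e∈δ h hf Zz≢Zw
    ... | no  x≢z  = Below-closed e′∈T e′≢f (Incident⇒Joins e′∋z e′∋x (x≢z ∘ sym))
                                  (unlike-w-below-parent e∈δ h hf Zz≢Zw)
      where
      e′≢f : e′ ≢ f
      e′≢f refl = e′∌p (Joins⇒Incidentʳ (Hangs.joins hf))

    upper-at-root-impossible : ∀ {e₁ e₂ c₁ c₂} (h₁ : Hangs e₁ c₁) (h₂ : Hangs e₂ c₂) →
                               e₁ ∈ᵇ δ G Z → e₂ ∈ᵇ δ G Z → Hangs.upper h₁ ≡ w → Hangs.upper h₂ ≢ w →
                               ¬ Incident G e₁ (Hangs.upper h₂) → ⊥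
    upper-at-root-impossible h₁ h₂ e₁∈δ e₂∈δ p₁≡w p₂≢w e₁∌p₂ =
      let f₂ , hf₂ = parent-edge (upper∈T h₂) p₂≢w
      in w-not-below f₂ (subst (Below f₂) p₁≡w
           (crossing-edge-below-parent e₂∈δ h₂ hf₂ (Hangs.edge∈T h₁) e₁∈δ e₁∌p₂
                                       (upper-incident h₁)))

    disjoint-crossing-tree-edges-impossible :
      ∀ {e₁ e₂} → e₁ ∈ᵇ TE T → e₁ ∈ᵇ δ G Z → e₂ ∈ᵇ TE T → e₂ ∈ᵇ δ G Z →
      ¬ (∀ {x} → Incident G e₁ x → ¬ Incident G e₂ x)
    disjoint-crossing-tree-edges-impossible e₁∈T e₁∈δ e₂∈T e₂∈δ disjoint
      with c₁ , h₁ ← tree-edge-hangs e₁∈T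
      with c₂ , h₂ ← tree-edge-hangs e₂∈T
      with Hangs.upper h₁ ≟ w | Hangs.upper h₂ ≟ w
    ... | yes p₁≡w | yes p₂≡w =
      disjoint (upper-incident h₁) (subst (Incident G _) (trans p₂≡w (sym p₁≡w)) (upper-incident h₂))
    ... | yes p₁≡w | no  p₂≢w =
      upper-at-root-impossible h₁ h₂ e₁∈δ e₂∈δ p₁≡w p₂≢w λ e₁∋p₂ → disjoint e₁∋p₂ (upper-incident h₂)
    ... | no  p₁≢w | yes p₂≡w =
      upper-at-root-impossible h₂ h₁ e₂∈δ e₁∈δ p₂≡w p₁≢w (disjoint (upper-incident h₁))
    ... | no  p₁≢w | no  p₂≢w =
      let f₁ , hf₁ = parent-edge (upper∈T h₁) p₁≢w
          f₂ , hf₂ = parent-edge (upper∈T h₂) p₂≢w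
          p₂-below-f₁ = crossing-edge-below-parent e₁∈δ h₁ hf₁ e₂∈T e₂∈δ
                          (disjoint (upper-incident h₁)) (upper-incident h₂)
          p₁-below-f₂ = crossing-edge-below-parent e₂∈δ h₂ hf₂ e₁∈T e₁∈δ
                          (λ e₁∋p₂ → disjoint e₁∋p₂ (upper-incident h₂)) (upper-incident h₁)
          p₁≡p₂ = hanging-antisym hf₁ hf₂ p₂-below-f₁ p₁-below-f₂
      in disjoint (upper-incident h₁) (subst (Incident G _) (sym p₁≡p₂) (upper-incident h₂))

    crossing-tree-edges-meet : ∀ {e₁ e₂} → e₁ ∈ᵇ TE T → e₁ ∈ᵇ δ G Z → e₂ ∈ᵇ TE T → e₂ ∈ᵇ δ G Z →
                               ∃[ x ] Incident G e₁ x × Incident G e₂ x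
    crossing-tree-edges-meet {e₁} {e₂} e₁∈T e₁∈δ e₂∈T e₂∈δ
      with Incident? {e = e₂} (src G e₁) | Incident? {e = e₂} (tgt G e₁)
    ... | yes e₂∋s | _        = src G e₁ , at-src refl , e₂∋s
    ... | no  _    | yes e₂∋t = tgt G e₁ , at-tgt refl , e₂∋t
    ... | no  e₂∌s | no  e₂∌t =
      contradiction (λ { {x} (at-src refl) → e₂∌s ; {x} (at-tgt refl) → e₂∌t })
                    (disjoint-crossing-tree-edges-impossible e₁∈T e₁∈δ e₂∈T e₂∈δ)

mainTheorem8 : (K : ℕ) → 1 ≤ K → (G : Graph) → KEdgeConnected K G →
    (R : CactusRep K G) → AtMostOnePerNode R →
    (Z : VSet G) → IsBasicKCut R Z →
    (T : Tree G) (w : Fin (nV G)) → Safe K G T w →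
    Σ (Fin (nE G)) (λ e → TE T e ≡ true × δ G Z e ≡ true) →
    Σ (Fin (nV G)) (λ x → (e : Fin (nE G)) → TE T e ≡ true → δ G Z e ≡ true →
      src G e ≡ x ⊎ tgt G e ≡ x)
mainTheorem8 K 1≤K G _ R _ Z basic T w safe (e₀ , e₀∈T , e₀∈δZ) =
  let x , all-at-x = meeting-edges-share-endpoint G Z D D⊆δZ meet (∧-true e₀∈T e₀∈δZ)
  in x , λ e e∈T e∈δZ → Incident⁻ (all-at-x e (∧-true e∈T e∈δZ))
  where
  open SafeTree 1≤K T w safe
  open NonCrossing Z (basicKCut-noncrossing R basic)
  D : ESet G
  D e = TE T e ∧ δ G Z e
  D⊆δZ : D ⊆ᵇ δ G Z
  D⊆δZ e = ∧-conicalʳ (TE T e) _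
  meet : ∀ {e₁ e₂} → e₁ ∈ᵇ D → e₂ ∈ᵇ D → ∃[ x ] Incident G e₁ x × Incident G e₂ x
  meet {e₁} {e₂} e₁∈D e₂∈D = crossing-tree-edges-meet (∧-conicalˡ (TE T e₁) _ e₁∈D) (D⊆δZ e₁ e₁∈D)
                                                      (∧-conicalˡ (TE T e₂) _ e₂∈D) (D⊆δZ e₂ e₂∈D)
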